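{- For each $n\geq1$, the number of connected spanning subgraphs of the Schreier graph $\Gamma_n$ of the Grigorchuk group is $2^{2^n+4}\cdot 3^{2^{n-1}-1}$.
   Context: Let $X^n$ denote the set of binary words of length $n$ over $\{0,1\}$. The Grigorchuk group is generated by the automorphisms $a,b,c,d$ of the rooted binary tree defined recursively on finite binary words $w$ by $a(0w)=1w$, $a(1w)=0w$, $b(0w)=0a(w)$, $b(1w)=1c(w)$, $c(0w)=0a(w)$, $c(1w)=1d(w)$, $d(0w)=0w$, $d(1w)=1b(w)$; each generator is an involution. For $n\geq1$, the Schreier graph $\Gamma_n$ is the finite multigraph with vertex set $X^n$ having, for each $s\in\{a,b,c,d\}$ and each orbit $\{u,s(u)\}$ of $s$ on $X^n$, one edge joining $u$ and $s(u)$ (a loop when $s(u)=u$). (As an unlabelled multigraph, $\Gamma_n$ has vertices $v_1,\dots,v_{2^n}$ on a line, a single edge between $v_{2k-1},v_{2k}$ for $1\le k\le 2^{n-1}$, two parallel edges between $v_{2k},v_{2k+1}$ for $1\le k\le 2^{n-1}-1$, one loop at each of $v_2,\dots,v_{2^n-1}$ and three loops at each of $v_1,v_{2^n}$.) A spanning subgraph is determined by a subset of the edge set (loops included, parallel edges distinct) together with all vertices. -}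

module Defs where

open import Data.Bool using (Bool; true; false; not; _∧_; if_then_else_)
open import Data.Bool.Properties using () renaming (_≟_ to _≟B_)
open import Data.Nat using (ℕ; zero; suc)
open import Data.Fin using (Fin)
open import Data.Fin.Subset using (Subset; _∈_)
open import Data.List using (List; []; _∷_; map; _++_; concatMap; filterᵇ; length; lookup)
open import Data.Vec using (Vec; []; _∷_)
open import Data.Product using (_×_; _,_; proj₁; proj₂; Σ)
open import Data.Sum using (_⊎_)
open import Data.List.Relation.Unary.Unique.Propositional using (Unique)
open import Data.List.Membership.Propositional using () renaming (_∈_ to _∈ˡ_)
open import Relation.Binary.PropositionalEquality using (_≡_)
open import Function.Bundles using (_⇔_)

-- Binary words of length n over {0,1}; false = 0, true = 1.
Word : ℕ → Set
Word n = Vec Bool n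

data Gen : Set where
  ga gb gc gd : Gen

act : ∀ {n} → Gen → Word n → Word n
act _  []            = []
act ga (x ∷ w)       = not x ∷ w
act gb (false ∷ w)   = false ∷ act ga w
act gb (true ∷ w)    = true ∷ act gc w
act gc (false ∷ w)   = false ∷ act ga w
act gc (true ∷ w)    = true ∷ act gd w
act gd (false ∷ w)   = false ∷ w
act gd (true ∷ w)    = true ∷ act gb w

words : (n : ℕ) → List (Word n)
words zero    = [] ∷ []
words (suc n) = map (false ∷_) (words n) ++ map (true ∷_) (words n)

-- Boolean equality and lexicographic order (used only to pick one
-- representative (u , s u) of each orbit {u , s u}).
eqB : Bool → Bool → Bool
eqB false false = true
eqB true  true  = true
eqB _     _     = false

lexLeq : ∀ {n} → Word n → Word n → Bool
lexLeq []      []      = true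
lexLeq (x ∷ u) (y ∷ v) = if eqB x y then lexLeq u v else (not x ∧ y)

gens : List Gen
gens = ga ∷ gb ∷ gc ∷ gd ∷ []

-- Edge list of the Schreier graph Γ_n: for each generator s and each
-- orbit {u, s u} of s on X^n, exactly one edge (u , s u) (a loop if s u = u).
edges : (n : ℕ) → List (Word n × Word n)
edges n = concatMap (λ s → map (λ u → u , act s u)
                              (filterᵇ (λ u → lexLeq u (act s u)) (words n)))
                    gens

numEdges : ℕ → ℕ
numEdges n = length (edges n)

Edge : ℕ → Set
Edge n = Fin (numEdges n)

src tgt : ∀ {n} → Edge n → Word n
src {n} e = proj₁ (lookup (edges n) e)
tgt {n} e = proj₂ (lookup (edges n) e)

-- A spanning subgraph of Γ_n = a subset of the edge set (all vertices kept).
SpanningSubgraph : ℕ → Set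
SpanningSubgraph n = Subset (numEdges n)

data Reach {n : ℕ} (S : SpanningSubgraph n) : Word n → Word n → Set where
  here  : ∀ {u} → Reach S u u
  fwd   : ∀ {w} (e : Edge n) → e ∈ S → Reach S (tgt {n} e) w → Reach S (src {n} e) w
  bwd   : ∀ {w} (e : Edge n) → e ∈ S → Reach S (src {n} e) w → Reach S (tgt {n} e) w

Connected : ∀ {n} → SpanningSubgraph n → Set
Connected {n} S = (u v : Word n) → Reach {n} S u v

NumConnectedSpanning : ℕ → ℕ → Set
NumConnectedSpanning n N =
  Σ (List (SpanningSubgraph n)) λ L →
    Unique L × ((S : SpanningSubgraph n) → (S ∈ˡ L) ⇔ Connected {n} S) × length L ≡ N

-- Number the vertices of Γ n along the path by positions 0, …, 2 ^ n − 1; the position of x ∷ w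
-- is 2 p or 2 p + 1, where p is the position of w.  Every edge is then a loop or joins two
-- consecutive positions, so a spanning subgraph is connected iff, for every gap j between
-- positions j and j + 1, it contains one of the m j edges crossing j.  Choosing independently
-- per gap, there are 2 ^ (number of loops) · ∏ j (2 ^ m j − 1) such subgraphs.  Since b, c, d
-- act below 0 as a, a, id and below 1 as c, d, b, the edges of Γ (n + 1) are prefixed copies of
-- edges of Γ n, and induction on n shows that in Γ (n + 1) every even gap is crossed once (by an
-- a-edge), every odd gap twice, and there are 2 ^ (n + 1) + 4 loops.  Hence the count
-- 2 ^ (2 ^ (n + 1) + 4) · 1 ^ (2 ^ n) · 3 ^ (2 ^ n − 1).
module Submission where

open import Defs
open import Data.Bool using (Bool; true; false; not; _∧_; _∨_; _xor_; if_then_else_)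
open import Data.Bool.Properties using (∨-identityʳ; xor-same; T-≡)
open import Data.Empty using (⊥; ⊥-elim)
open import Data.Fin using (zero; suc)
open import Data.Fin.Subset using (Subset; inside; outside) renaming (_∈_ to _∈ₛ_)
open import Data.List using (List; []; _∷_; [_]; map; _++_; length; lookup; filter; filterᵇ; downFrom)
open import Data.List.Membership.Propositional using (_∈_; _∉_)
open import Data.List.Membership.Propositional.Properties
  using (∈-filter⁻; ∈-filter⁺; ∈-map⁻; ∈-map⁺; ∈-++⁻; ∈-++⁺ˡ; ∈-++⁺ʳ; ∈-downFrom⁺; ∈-downFrom⁻; ∈-lookup)
open import Data.List.Properties
  using (map-++; map-∘; map-cong; map-cong-local; filter-++; filter-all; filter-accept; filter-reject;
         ++-identityʳ; length-++; length-map)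
open import Data.List.Relation.Unary.All as All using (All; []; _∷_)
open import Data.List.Relation.Unary.All.Properties using (map⁺; ++⁺)
open import Data.List.Relation.Unary.AllPairs using ([]; _∷_)
open import Data.List.Relation.Unary.Any using (here; there)
open import Data.List.Relation.Unary.Unique.Propositional using (Unique)
import Data.List.Relation.Unary.Unique.Propositional.Properties as Unique
open import Data.Maybe using (Maybe; just; nothing; is-nothing)
open import Data.Maybe.Properties using (≡-dec; just-injective)
import Data.Maybe.Relation.Unary.All as Maybe
open import Data.Nat using (ℕ; zero; suc; _+_; _*_; _^_; _∸_; _<_; _≤_; z≤n; s≤s; _≤?_; _≡ᵇ_; ⌊_/2⌋)
import Data.Nat as ℕ
open import Data.Nat.ListAction using (product)
open import Data.Nat.Properties
  using (suc-injective; +-suc; +-comm; +-identityʳ; ^-distribˡ-+-*; m∸n+n≡m; m^n>0; ≡ᵇ⇒≡;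
         ≤-refl; ≤-trans; ≤-antisym; ≤-pred; n≤1+n; n<1+n; m≤n⇒m≤1+n; <-trans; <⇒≱; ≰⇒>; ⌊n/2⌋-mono;
         *-commutativeSemigroup)
open import Algebra.Properties.CommutativeSemigroup *-commutativeSemigroup using (x∙yz≈y∙xz)
open import Data.Nat.Tactic.RingSolver using (solve-∀)
open import Data.Product using (_×_; _,_; proj₁; proj₂; map₂; ∃-syntax)
open import Data.Sum using (_⊎_; inj₁; inj₂)
open import Data.Unit using (tt)
open import Data.Vec using ([]; _∷_; here; there)
open import Data.Vec.Properties using (∷-injectiveˡ; ∷-injectiveʳ)
open import Function using (_∘_; const; _⇔_; mk⇔; Equivalence)
import Function.Properties.Equivalence as ⇔
open import Relation.Binary.Definitions using (DecidableEquality)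
open import Relation.Binary.PropositionalEquality hiding ([_])
open import Relation.Nullary using (Dec; ¬_; ¬?; yes; no; does; contradiction)
open import Relation.Nullary.Decidable using (dec-true; dec-false; does-⇔)
open import Relation.Unary using (Decidable)
open ≡-Reasoning

module _ {A : Set} where

  count : (A → Bool) → List A → ℕ
  count p []       = 0
  count p (x ∷ xs) = if p x then suc (count p xs) else count p xs

  count-++ : ∀ p xs ys → count p (xs ++ ys) ≡ count p xs + count p ys
  count-++ p []       ys = refl
  count-++ p (x ∷ xs) ys with p x
  ... | true  = cong suc (count-++ p xs ys)
  ... | false = count-++ p xs ys

  count-cong : ∀ {p q} → (∀ x → p x ≡ q x) → ∀ xs → count p xs ≡ count q xs
  count-cong p≗q []       = refl
  count-cong {q = q} p≗q (x ∷ xs) rewrite p≗q x with q x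
  ... | true  = cong suc (count-cong p≗q xs)
  ... | false = count-cong p≗q xs

  count-none : ∀ {p} → (∀ x → p x ≡ false) → ∀ xs → count p xs ≡ 0
  count-none none []       = refl
  count-none none (x ∷ xs) rewrite none x = count-none none xs

  count-all : ∀ {p} → (∀ x → p x ≡ true) → ∀ xs → count p xs ≡ length xs
  count-all all []       = refl
  count-all all (x ∷ xs) rewrite all x = cong suc (count-all all xs)

  count-∨ : ∀ p q → (∀ x → p x ∧ q x ≡ false) →
            ∀ xs → count (λ x → p x ∨ q x) xs ≡ count p xs + count q xs
  count-∨ p q disjoint []       = refl
  count-∨ p q disjoint (x ∷ xs) with p x | q x | disjoint x
  ... | true  | false | _ = cong suc (count-∨ p q disjoint xs)
  ... | false | true  | _ = trans (cong suc (count-∨ p q disjoint xs)) (sym (+-suc _ _))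
  ... | false | false | _ = count-∨ p q disjoint xs

count-map : ∀ {A B : Set} (p : B → Bool) (f : A → B) xs → count p (map f xs) ≡ count (λ x → p (f x)) xs
count-map p f []       = refl
count-map p f (x ∷ xs) with p (f x)
... | true  = cong suc (count-map p f xs)
... | false = count-map p f xs

double : ℕ → ℕ
double zero    = zero
double (suc k) = suc (suc (double k))

double-injective : ∀ {k l} → double k ≡ double l → k ≡ l
double-injective {zero}  {zero}  _  = refl
double-injective {suc k} {suc l} eq = cong suc (double-injective (suc-injective (suc-injective eq)))

double≢suc-double : ∀ k l → double k ≢ suc (double l)
double≢suc-double (suc k) (suc l) eq = double≢suc-double k l (suc-injective (suc-injective eq))

double-mono-≤ : ∀ {k l} → k ≤ l → double k ≤ double l
double-mono-≤ z≤n       = z≤n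
double-mono-≤ (s≤s k≤l) = s≤s (s≤s (double-mono-≤ k≤l))

double-cancel-< : ∀ {k l} → double k < double l → k < l
double-cancel-< {zero}  {suc l} _             = s≤s z≤n
double-cancel-< {suc k} {suc l} (s≤s (s≤s h)) = s≤s (double-cancel-< h)

2^suc≡double : ∀ n → 2 ^ suc n ≡ double (2 ^ n)
2^suc≡double n = trans (cong (2 ^ n +_) (+-identityʳ (2 ^ n))) (sym (double≡+ (2 ^ n)))
  where
  double≡+ : ∀ k → double k ≡ k + k
  double≡+ zero    = refl
  double≡+ (suc k) = cong suc (trans (cong suc (double≡+ k)) (sym (+-suc k k)))

data Parity : ℕ → Set where
  even : ∀ k → Parity (double k)
  odd  : ∀ k → Parity (suc (double k))

parity : ∀ n → Parity n
parity zero = even zero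
parity (suc n) with parity n
... | even k = odd k
... | odd k  = even (suc k)

isOdd : ℕ → Bool
isOdd zero          = false
isOdd (suc zero)    = true
isOdd (suc (suc n)) = isOdd n

isOdd-double : ∀ k → isOdd (double k) ≡ false
isOdd-double zero    = refl
isOdd-double (suc k) = isOdd-double k

isOdd-suc-double : ∀ k → isOdd (suc (double k)) ≡ true
isOdd-suc-double zero    = refl
isOdd-suc-double (suc k) = isOdd-suc-double k

suc[2^n∸1]≡2^n : ∀ n → suc (2 ^ n ∸ 1) ≡ 2 ^ n
suc[2^n∸1]≡2^n n = trans (+-comm 1 (2 ^ n ∸ 1)) (m∸n+n≡m (m^n>0 2 n))

double-≡ᵇ-double : ∀ k l → (double k ≡ᵇ double l) ≡ (k ≡ᵇ l)
double-≡ᵇ-double zero    zero    = refl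
double-≡ᵇ-double zero    (suc l) = refl
double-≡ᵇ-double (suc k) zero    = refl
double-≡ᵇ-double (suc k) (suc l) = double-≡ᵇ-double k l

double-≡ᵇ-suc-double : ∀ k l → (double k ≡ᵇ suc (double l)) ≡ false
double-≡ᵇ-suc-double zero    l       = refl
double-≡ᵇ-suc-double (suc k) zero    = refl
double-≡ᵇ-suc-double (suc k) (suc l) = double-≡ᵇ-suc-double k l

suc-double-≡ᵇ-double : ∀ k l → (suc (double k) ≡ᵇ double l) ≡ false
suc-double-≡ᵇ-double k       zero    = refl
suc-double-≡ᵇ-double zero    (suc l) = refl
suc-double-≡ᵇ-double (suc k) (suc l) = suc-double-≡ᵇ-double k l

⌊double/2⌋ : ∀ q → ⌊ double q /2⌋ ≡ q
⌊double/2⌋ zero    = refl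
⌊double/2⌋ (suc q) = cong suc (⌊double/2⌋ q)

⌊suc-double/2⌋ : ∀ q → ⌊ suc (double q) /2⌋ ≡ q
⌊suc-double/2⌋ zero    = refl
⌊suc-double/2⌋ (suc q) = cong suc (⌊suc-double/2⌋ q)

≡ᵇ-true : ∀ {k l} → (k ≡ᵇ l) ≡ true → k ≡ l
≡ᵇ-true {k} {l} e = ≡ᵇ⇒≡ k l (Equivalence.from T-≡ e)

xor-cancelʳ : ∀ b {x y} → x xor b ≡ y xor b → x ≡ y
xor-cancelʳ b     {false} {false} _  = refl
xor-cancelʳ b     {true}  {true}  _  = refl
xor-cancelʳ false {false} {true}  ()
xor-cancelʳ true  {false} {true}  ()
xor-cancelʳ false {true}  {false} ()
xor-cancelʳ true  {true}  {false} ()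

-- Subsets of edges covering the gaps of a line

-- Edges are seen only through the gap they cross: just j for an edge between j and j + 1,
-- nothing for a loop.
module Covering {B : Set} (_≟_ : DecidableEquality B) where

  open import Data.List.Membership.DecPropositional _≟_ using (_∈?_)

  _≟ₘ_ : DecidableEquality (Maybe B)
  _≟ₘ_ = ≡-dec _≟_

  multiplicity : B → List (Maybe B) → ℕ
  multiplicity j = count (λ m → does (m ≟ₘ just j))

  gapIn : List B → Maybe B → Bool
  gapIn R nothing  = false
  gapIn R (just j) = does (j ∈? R)

  free : List B → List (Maybe B) → ℕ
  free R = count (not ∘ gapIn R)

  loops : List (Maybe B) → ℕ
  loops = count is-nothing

  -- A gap crossed by m edges can be covered in 2 ^ m − 1 ways.
  choices : List B → List (Maybe B) → ℕ
  choices R s = product (map (λ j → 2 ^ multiplicity j s ∸ 1) R)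

  uncover : Maybe B → List B → List B
  uncover nothing  R = R
  uncover (just k) R = filter (λ j → ¬? (j ≟ k)) R

  ∈-uncover⁻ : ∀ {j} m R → j ∈ uncover m R → j ∈ R × m ≢ just j
  ∈-uncover⁻ nothing  R j∈R = j∈R , λ ()
  ∈-uncover⁻ (just k) R j∈R∖k with j∈R , j≢k ← ∈-filter⁻ (λ j → ¬? (j ≟ k)) j∈R∖k =
    j∈R , λ k≡j → j≢k (sym (just-injective k≡j))

  ∈-uncover⁺ : ∀ {j} m R → j ∈ R → m ≢ just j → j ∈ uncover m R
  ∈-uncover⁺ nothing  R j∈R _   = j∈R
  ∈-uncover⁺ (just k) R j∈R m≢j = ∈-filter⁺ (λ j → ¬? (j ≟ k)) j∈R (λ j≡k → m≢j (cong just (sym j≡k)))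

  multiplicity-cons-other : ∀ {j} m s → m ≢ just j → multiplicity j (m ∷ s) ≡ multiplicity j s
  multiplicity-cons-other {j} m s m≢j rewrite dec-false (m ≟ₘ just j) m≢j = refl

  multiplicity-cons-same : ∀ j s → multiplicity j (just j ∷ s) ≡ suc (multiplicity j s)
  multiplicity-cons-same j s rewrite dec-true (just j ≟ₘ just j) refl = refl

  choices-cong : ∀ R {s t} → (∀ {j} → j ∈ R → multiplicity j s ≡ multiplicity j t) → choices R s ≡ choices R t
  choices-cong []      _    = refl
  choices-cong (j ∷ R) {s} {t} s≈t =
    cong₂ (λ m c → (2 ^ m ∸ 1) * c) (s≈t (here refl)) (choices-cong R {s} {t} (λ j∈R → s≈t (there j∈R)))

  gapIn-just : ∀ {j R} → j ∈ R → gapIn R (just j) ≡ true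
  gapIn-just {j} {R} j∈R = dec-true (j ∈? R) j∈R

  module _ {R : List B} {m : Maybe B} (m∉R : gapIn R m ≡ false) where

    ≢-outside : ∀ {j} → j ∈ R → m ≢ just j
    ≢-outside j∈R refl with () ← trans (sym m∉R) (gapIn-just j∈R)

    free-cons-outside : ∀ s → free R (m ∷ s) ≡ suc (free R s)
    free-cons-outside s rewrite m∉R = refl

    choices-cons-outside : ∀ s → choices R (m ∷ s) ≡ choices R s
    choices-cons-outside s = choices-cong R {m ∷ s} {s} λ j∈R → multiplicity-cons-other m s (≢-outside j∈R)

  uncover-outside : ∀ m R → gapIn R m ≡ false → uncover m R ≡ R
  uncover-outside nothing  R _   = refl
  uncover-outside (just k) R k∉R =
    filter-all (λ j → ¬? (j ≟ k)) (All.tabulate λ j∈R j≡k → ≢-outside k∉R j∈R (cong just (sym j≡k)))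

  module _ {R : List B} {k : B} (k∈R : k ∈ R) where

    private
      R∖k = uncover (just k) R

    ∉-uncover : k ∉ R∖k
    ∉-uncover k∈R∖k with () ← proj₂ (∈-uncover⁻ (just k) R k∈R∖k) refl

    free-cons-inside : ∀ s → free R (just k ∷ s) ≡ free R s
    free-cons-inside s rewrite gapIn-just k∈R = refl

    gapIn-uncover : ∀ {j} → j ≢ k → gapIn R∖k (just j) ≡ gapIn R (just j)
    gapIn-uncover {j} j≢k = does-⇔
      (mk⇔ (proj₁ ∘ ∈-uncover⁻ (just k) R) (λ j∈R → ∈-uncover⁺ (just k) R j∈R (j≢k ∘ sym ∘ just-injective)))
      (j ∈? R∖k) (j ∈? R)

    private
      free-uncover-just : ∀ {j} → Dec (j ≡ k) → ∀ s → free R∖k s ≡ free R s + multiplicity k s →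
                          free R∖k (just j ∷ s) ≡ free R (just j ∷ s) + multiplicity k (just j ∷ s)
      free-uncover-just (yes refl) s ih = begin
        free R∖k (just k ∷ s)
          ≡⟨ free-cons-outside (dec-false (k ∈? R∖k) ∉-uncover) s ⟩
        suc (free R∖k s)
          ≡⟨ cong suc ih ⟩
        suc (free R s + multiplicity k s)
          ≡⟨ +-suc _ _ ⟨
        free R s + suc (multiplicity k s)
          ≡⟨ cong₂ _+_ (free-cons-inside s) (multiplicity-cons-same k s) ⟨
        free R (just k ∷ s) + multiplicity k (just k ∷ s) ∎
      free-uncover-just {j} (no j≢k) s ih
        rewrite gapIn-uncover j≢k | multiplicity-cons-other (just j) s (j≢k ∘ just-injective)
        with gapIn R (just j)
      ... | true  = ih
      ... | false = cong suc ih

    free-uncover : ∀ s → free R∖k s ≡ free R s + multiplicity k s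
    free-uncover []            = refl
    free-uncover (nothing ∷ s) = cong suc (free-uncover s)
    free-uncover (just j ∷ s)  = free-uncover-just (j ≟ k) s (free-uncover s)

  choices-uncover : ∀ {k} R s → Unique R → k ∈ R →
                    choices R s ≡ (2 ^ multiplicity k s ∸ 1) * choices (uncover (just k) R) s
  choices-uncover {k} (k ∷ R) s (k∉R ∷ _) (here refl) =
    cong (λ R′ → (2 ^ multiplicity k s ∸ 1) * choices R′ s) (sym uncover-head)
    where
    uncover-head : uncover (just k) (k ∷ R) ≡ R
    uncover-head = trans (filter-reject (λ j → ¬? (j ≟ k)) (λ k≢k → k≢k refl))
                         (filter-all (λ j → ¬? (j ≟ k)) (All.map (λ k≢j j≡k → k≢j (sym j≡k)) k∉R))
  choices-uncover {k} (j ∷ R) s (j∉R ∷ u) (there k∈R)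
    rewrite filter-accept (λ i → ¬? (i ≟ k)) {j} {R} (All.lookup j∉R k∈R) | choices-uncover R s u k∈R =
    x∙yz≈y∙xz (2 ^ multiplicity j s ∸ 1) (2 ^ multiplicity k s ∸ 1) _

  numCoverings : List B → List (Maybe B) → ℕ
  numCoverings R s = 2 ^ free R s * choices R s

  numCoverings-outside : ∀ {R m} → gapIn R m ≡ false → ∀ s →
                         numCoverings (uncover m R) s + numCoverings R s ≡ numCoverings R (m ∷ s)
  numCoverings-outside {R} {m} m∉R s = begin
    numCoverings (uncover m R) s + numCoverings R s
      ≡⟨ cong (λ R′ → numCoverings R′ s + numCoverings R s) (uncover-outside m R m∉R) ⟩
    2 ^ free R s * choices R s + 2 ^ free R s * choices R s
      ≡⟨ twice (2 ^ free R s) (choices R s) ⟩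
    2 ^ suc (free R s) * choices R s
      ≡⟨ cong₂ (λ f c → 2 ^ f * c) (free-cons-outside {R} {m} m∉R s) (choices-cons-outside {R} {m} m∉R s) ⟨
    numCoverings R (m ∷ s) ∎
    where
    twice : ∀ x c → x * c + x * c ≡ 2 * x * c
    twice = solve-∀

  numCoverings-inside : ∀ {R k} → Unique R → k ∈ R → ∀ s →
                        numCoverings (uncover (just k) R) s + numCoverings R s ≡ numCoverings R (just k ∷ s)
  numCoverings-inside {R} {k} u k∈R s = begin
    numCoverings R∖k s + numCoverings R s
      ≡⟨ cong₂ (λ f c → 2 ^ f * P + 2 ^ F * c) (free-uncover k∈R s) (choices-uncover R s u k∈R) ⟩
    2 ^ (F + M) * P + 2 ^ F * ((2 ^ M ∸ 1) * P)
      ≡⟨ cong (λ x → x * P + 2 ^ F * ((2 ^ M ∸ 1) * P)) (^-distribˡ-+-* 2 F M) ⟩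
    2 ^ F * 2 ^ M * P + 2 ^ F * ((2 ^ M ∸ 1) * P)
      ≡⟨ cong (λ x → 2 ^ F * x * P + 2 ^ F * ((2 ^ M ∸ 1) * P)) (sym (suc[2^n∸1]≡2^n M)) ⟩
    2 ^ F * suc (2 ^ M ∸ 1) * P + 2 ^ F * ((2 ^ M ∸ 1) * P)
      ≡⟨ add-odd (2 ^ F) (2 ^ M ∸ 1) P ⟩
    2 ^ F * ((2 * suc (2 ^ M ∸ 1) ∸ 1) * P)
      ≡⟨ cong (λ x → 2 ^ F * ((2 * x ∸ 1) * P)) (sym (suc[2^n∸1]≡2^n M)) ⟨
    2 ^ F * ((2 ^ suc M ∸ 1) * P)
      ≡⟨ cong₂ (λ f m → 2 ^ f * ((2 ^ m ∸ 1) * P)) (free-cons-inside k∈R s) (multiplicity-cons-same k s) ⟨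
    2 ^ free R (just k ∷ s) * ((2 ^ multiplicity k (just k ∷ s) ∸ 1) * P)
      ≡⟨ cong (λ c → 2 ^ free R (just k ∷ s) * ((2 ^ multiplicity k (just k ∷ s) ∸ 1) * c))
              (choices-cons-outside {R∖k} {just k} (dec-false (k ∈? R∖k) (∉-uncover k∈R)) s) ⟨
    2 ^ free R (just k ∷ s) * ((2 ^ multiplicity k (just k ∷ s) ∸ 1) * choices R∖k (just k ∷ s))
      ≡⟨ cong (2 ^ free R (just k ∷ s) *_) (choices-uncover R (just k ∷ s) u k∈R) ⟨
    numCoverings R (just k ∷ s) ∎
    where
    R∖k = uncover (just k) R
    F = free R s
    M = multiplicity k s
    P = choices R∖k s
    add-odd : ∀ a t p → a * suc t * p + a * (t * p) ≡ a * ((t + suc (t + 0)) * p)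
    add-odd = solve-∀

  numCoverings-step : ∀ m {R} → Unique R → ∀ s →
                      numCoverings (uncover m R) s + numCoverings R s ≡ numCoverings R (m ∷ s)
  numCoverings-step nothing  {R} _ = numCoverings-outside {R} {nothing} refl
  numCoverings-step (just k) {R} u = by-membership (k ∈? R)
    where
    by-membership : Dec (k ∈ R) → ∀ s →
                    numCoverings (uncover (just k) R) s + numCoverings R s ≡ numCoverings R (just k ∷ s)
    by-membership (yes k∈R) = numCoverings-inside u k∈R
    by-membership (no  k∉R) = numCoverings-outside {R} {just k} (dec-false (k ∈? R) k∉R)

  uncover-unique : ∀ m {R} → Unique R → Unique (uncover m R)
  uncover-unique nothing  u = u
  uncover-unique (just k) u = Unique.filter⁺ (λ j → ¬? (j ≟ k)) u

  free-all-inside : ∀ {R s} → All (Maybe.All (_∈ R)) s → free R s ≡ loops s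
  free-all-inside []                              = refl
  free-all-inside {s = nothing ∷ s} (_ ∷ ps)        = cong suc (free-all-inside ps)
  free-all-inside {s = just j ∷ s} (Maybe.just j∈R ∷ ps) rewrite gapIn-just j∈R = free-all-inside ps

  module _ {A : Set} (gapOf : A → Maybe B) where

    Covers : (E : List A) → List B → Subset (length E) → Set
    Covers E R S = ∀ {j} → j ∈ R → ∃[ i ] i ∈ₛ S × gapOf (lookup E i) ≡ just j

    coveringSubsets : (E : List A) → List B → List (Subset (length E))
    coveringSubsets []      []      = [ [] ]
    coveringSubsets []      (_ ∷ _) = []
    coveringSubsets (x ∷ E) R =
      map (inside ∷_) (coveringSubsets E (uncover (gapOf x) R)) ++ map (outside ∷_) (coveringSubsets E R)

    Covers-inside : ∀ x E R S → Covers (x ∷ E) R (inside ∷ S) ⇔ Covers E (uncover (gapOf x) R) S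
    Covers-inside x E R S = mk⇔ from to
      where
      from : Covers (x ∷ E) R (inside ∷ S) → Covers E (uncover (gapOf x) R) S
      from cov j∈R∖x with j∈R , x≢j ← ∈-uncover⁻ (gapOf x) R j∈R∖x | cov j∈R
      ... | zero  , _          , x≡j = contradiction x≡j x≢j
      ... | suc i , there i∈S , e≡j = i , i∈S , e≡j
      to : Covers E (uncover (gapOf x) R) S → Covers (x ∷ E) R (inside ∷ S)
      to cov {j} j∈R with gapOf x ≟ₘ just j
      ... | yes x≡j = zero , here , x≡j
      ... | no  x≢j with i , i∈S , e≡j ← cov (∈-uncover⁺ (gapOf x) R j∈R x≢j) = suc i , there i∈S , e≡j

    Covers-outside : ∀ x E R S → Covers (x ∷ E) R (outside ∷ S) ⇔ Covers E R S
    Covers-outside x E R S = mk⇔ from to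
      where
      from : Covers (x ∷ E) R (outside ∷ S) → Covers E R S
      from cov j∈R with cov j∈R
      ... | suc i , there i∈S , e≡j = i , i∈S , e≡j
      to : Covers E R S → Covers (x ∷ E) R (outside ∷ S)
      to cov j∈R with i , i∈S , e≡j ← cov j∈R = suc i , there i∈S , e≡j

    ∈-coveringSubsets⁺ : ∀ E R S → Covers E R S → S ∈ coveringSubsets E R
    ∈-coveringSubsets⁺ []      []      []          cov = here refl
    ∈-coveringSubsets⁺ []      (j ∷ R) []          cov with () , _ ← cov (here refl)
    ∈-coveringSubsets⁺ (x ∷ E) R       (true ∷ S)  cov =
      ∈-++⁺ˡ (∈-map⁺ (inside ∷_) (∈-coveringSubsets⁺ E _ S (Equivalence.to (Covers-inside x E R S) cov)))
    ∈-coveringSubsets⁺ (x ∷ E) R       (false ∷ S) cov =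
      ∈-++⁺ʳ _ (∈-map⁺ (outside ∷_) (∈-coveringSubsets⁺ E R S (Equivalence.to (Covers-outside x E R S) cov)))

    ∈-coveringSubsets⁻ : ∀ E R S → S ∈ coveringSubsets E R → Covers E R S
    ∈-coveringSubsets⁻ []      []      [] _ ()
    ∈-coveringSubsets⁻ (x ∷ E) R       S  S∈
      with ∈-++⁻ (map (inside ∷_) (coveringSubsets E (uncover (gapOf x) R))) S∈
    ... | inj₁ S∈ˡ with S′ , S′∈ , refl ← ∈-map⁻ (inside ∷_) S∈ˡ =
      Equivalence.from (Covers-inside x E R S′) (∈-coveringSubsets⁻ E _ S′ S′∈)
    ... | inj₂ S∈ʳ with S′ , S′∈ , refl ← ∈-map⁻ (outside ∷_) S∈ʳ =
      Equivalence.from (Covers-outside x E R S′) (∈-coveringSubsets⁻ E R S′ S′∈)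

    coveringSubsets-unique : ∀ E R → Unique (coveringSubsets E R)
    coveringSubsets-unique []      []      = [] ∷ []
    coveringSubsets-unique []      (_ ∷ _) = []
    coveringSubsets-unique (x ∷ E) R = Unique.++⁺
      (Unique.map⁺ ∷-injectiveʳ (coveringSubsets-unique E _))
      (Unique.map⁺ ∷-injectiveʳ (coveringSubsets-unique E R))
      λ (S∈ˡ , S∈ʳ) → sides-differ (∈-map⁻ (inside ∷_) S∈ˡ) (∈-map⁻ (outside ∷_) S∈ʳ)
      where
      sides-differ : ∀ {S} → ∃[ T ] _ × S ≡ inside ∷ T → ∃[ T ] _ × S ≡ outside ∷ T → ⊥
      sides-differ (_ , _ , S≡in) (_ , _ , S≡out) with () ← ∷-injectiveˡ (trans (sym S≡in) S≡out)

    length-coveringSubsets : ∀ E {R} → Unique R → length (coveringSubsets E R) ≡ numCoverings R (map gapOf E)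
    length-coveringSubsets []      {[]}    _ = refl
    length-coveringSubsets []      {_ ∷ _} _ = refl
    length-coveringSubsets (x ∷ E) {R}     u = begin
      length (map (inside ∷_) (coveringSubsets E R∖x) ++ map (outside ∷_) (coveringSubsets E R))
        ≡⟨ length-++ (map (inside ∷_) (coveringSubsets E R∖x)) ⟩
      length (map (inside ∷_) (coveringSubsets E R∖x)) + length (map (outside ∷_) (coveringSubsets E R))
        ≡⟨ cong₂ _+_ (length-map (inside ∷_) (coveringSubsets E R∖x))
                     (length-map (outside ∷_) (coveringSubsets E R)) ⟩
      length (coveringSubsets E R∖x) + length (coveringSubsets E R)
        ≡⟨ cong₂ _+_ (length-coveringSubsets E (uncover-unique (gapOf x) u)) (length-coveringSubsets E u) ⟩
      numCoverings R∖x (map gapOf E) + numCoverings R (map gapOf E)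
        ≡⟨ numCoverings-step (gapOf x) u (map gapOf E) ⟩
      numCoverings R (map gapOf (x ∷ E)) ∎
      where
      R∖x = uncover (gapOf x) R

    ∈-coveringSubsets : ∀ E R S → S ∈ coveringSubsets E R ⇔ Covers E R S
    ∈-coveringSubsets E R S = mk⇔ (∈-coveringSubsets⁻ E R S) (∈-coveringSubsets⁺ E R S)

open Covering ℕ._≟_

-- Positions of the vertices of Γ n

-- x ∷ w is an end of the a-edge {0 ∷ w, 1 ∷ w}, placed at positions 2 p and 2 p + 1 with p the
-- position of w; the parity of p decides which end is which.
extend : Bool → ℕ → ℕ
extend x p = if x xor isOdd p then double p else suc (double p)

position : ∀ {n} → Word n → ℕ
position []      = 0
position (x ∷ w) = extend x (position w)

extend-false-double : ∀ k → extend false (double k) ≡ suc (double (double k))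
extend-false-double k rewrite isOdd-double k = refl

extend-false-suc-double : ∀ k → extend false (suc (double k)) ≡ double (suc (double k))
extend-false-suc-double k rewrite isOdd-suc-double k = refl

extend-true-double : ∀ k → extend true (double k) ≡ double (double k)
extend-true-double k rewrite isOdd-double k = refl

extend-true-suc-double : ∀ k → extend true (suc (double k)) ≡ suc (double (suc (double k)))
extend-true-suc-double k rewrite isOdd-suc-double k = refl

extend-injective : ∀ {x y p q} → extend x p ≡ extend y q → x ≡ y × p ≡ q
extend-injective {x} {y} {p} {q} eq with x xor isOdd p in ex | y xor isOdd q in ey
... | true  | false = ⊥-elim (double≢suc-double p q eq)
... | false | true  = ⊥-elim (double≢suc-double q p (sym eq))
... | true  | true  with refl ← double-injective eq =
  xor-cancelʳ (isOdd p) (trans ex (sym ey)) , refl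
... | false | false with refl ← double-injective (suc-injective eq) =
  xor-cancelʳ (isOdd p) (trans ex (sym ey)) , refl

position-injective : ∀ {n} {u v : Word n} → position u ≡ position v → u ≡ v
position-injective {u = []}    {[]}    _  = refl
position-injective {u = x ∷ u} {y ∷ v} eq with refl , eq′ ← extend-injective {x} {y} eq =
  cong (x ∷_) (position-injective eq′)

position<2^n : ∀ {n} (w : Word n) → position w < 2 ^ n
position<2^n []            = s≤s z≤n
position<2^n {suc n} (x ∷ w) = subst (extend x (position w) <_) (sym (2^suc≡double n))
  (≤-trans (s≤s (extend≤ x (position w))) (double-mono-≤ (position<2^n w)))
  where
  extend≤ : ∀ x p → extend x p ≤ suc (double p)
  extend≤ x p with x xor isOdd p
  ... | true  = n≤1+n _
  ... | false = ≤-refl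

firstWord : ∀ n → Word n
firstWord zero    = []
firstWord (suc n) = true ∷ firstWord n

position-firstWord : ∀ n → position (firstWord n) ≡ 0
position-firstWord zero = refl
position-firstWord (suc n) rewrite position-firstWord n = refl

lastWord : ∀ n → Word n
lastWord zero    = []
lastWord (suc n) = isOdd (position (lastWord n)) ∷ lastWord n

position-lastWord : ∀ n → suc (position (lastWord n)) ≡ 2 ^ n
position-lastWord zero = refl
position-lastWord (suc n) rewrite xor-same (isOdd (position (lastWord n))) =
  trans (cong double (position-lastWord n)) (sym (2^suc≡double n))

extend-fibre : ∀ p k → (extend false p ≡ᵇ k) ∨ (extend true p ≡ᵇ k) ≡ (p ≡ᵇ ⌊ k /2⌋)
extend-fibre p k with parity p | parity k
... | even r | even q rewrite extend-false-double r | extend-true-double r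
  | suc-double-≡ᵇ-double (double r) q | double-≡ᵇ-double (double r) q | ⌊double/2⌋ q = refl
... | even r | odd q rewrite extend-false-double r | extend-true-double r
  | double-≡ᵇ-double (double r) q | double-≡ᵇ-suc-double (double r) q | ⌊suc-double/2⌋ q = ∨-identityʳ _
... | odd r | even q rewrite extend-false-suc-double r | extend-true-suc-double r
  | double-≡ᵇ-double (suc (double r)) q | suc-double-≡ᵇ-double (suc (double r)) q | ⌊double/2⌋ q = ∨-identityʳ _
... | odd r | odd q rewrite extend-false-suc-double r | extend-true-suc-double r
  | double-≡ᵇ-suc-double (suc (double r)) q | double-≡ᵇ-double (suc (double r)) q | ⌊suc-double/2⌋ q = refl

extend-ends-disjoint : ∀ p k → (extend false p ≡ᵇ k) ∧ (extend true p ≡ᵇ k) ≡ false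
extend-ends-disjoint p k with extend false p ≡ᵇ k in e₁ | extend true p ≡ᵇ k in e₂
... | false | _     = refl
... | true  | false = refl
... | true  | true
  with () ← proj₁ (extend-injective {false} {true} {p} {p} (trans (≡ᵇ-true e₁) (sym (≡ᵇ-true e₂))))

positions-fibre : ∀ n k → k < 2 ^ n → count (λ w → position w ≡ᵇ k) (words n) ≡ 1
positions-fibre zero    zero    _             = refl
positions-fibre zero    (suc k) (s≤s ())
positions-fibre (suc n) k k<2^sn = begin
  count (λ w → position w ≡ᵇ k) (map (false ∷_) W ++ map (true ∷_) W)
    ≡⟨ count-++ _ (map (false ∷_) W) (map (true ∷_) W) ⟩
  count (λ w → position w ≡ᵇ k) (map (false ∷_) W) + count (λ w → position w ≡ᵇ k) (map (true ∷_) W)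
    ≡⟨ cong₂ _+_ (count-map _ (false ∷_) W) (count-map _ (true ∷_) W) ⟩
  count (λ w → extend false (position w) ≡ᵇ k) W + count (λ w → extend true (position w) ≡ᵇ k) W
    ≡⟨ count-∨ _ _ (λ w → extend-ends-disjoint (position w) k) W ⟨
  count (λ w → (extend false (position w) ≡ᵇ k) ∨ (extend true (position w) ≡ᵇ k)) W
    ≡⟨ count-cong (λ w → extend-fibre (position w) k) W ⟩
  count (λ w → position w ≡ᵇ ⌊ k /2⌋) W
    ≡⟨ positions-fibre n ⌊ k /2⌋ ⌊k/2⌋<2^n ⟩
  1 ∎
  where
  W = words n
  ⌊k/2⌋<2^n : ⌊ k /2⌋ < 2 ^ n
  ⌊k/2⌋<2^n = subst (suc ⌊ k /2⌋ ≤_) (⌊suc-double/2⌋ (2 ^ n))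
    (⌊n/2⌋-mono (s≤s (subst (k <_) (2^suc≡double n) k<2^sn)))

-- The edges of Γ (n + 1) in terms of those of Γ n

edgesAmong : ∀ {n} → Gen → List (Word n) → List (Word n × Word n)
edgesAmong s W = map (λ u → u , act s u) (filterᵇ (λ u → lexLeq u (act s u)) W)

edgesOf : Gen → (n : ℕ) → List (Word n × Word n)
edgesOf s n = edgesAmong s (words n)

prefix : ∀ {n} → Bool → Word n × Word n → Word (suc n) × Word (suc n)
prefix x (u , v) = x ∷ u , x ∷ v

loopAt : ∀ {n} → Word n → Word n × Word n
loopAt w = w , w

eqB-refl : ∀ x → eqB x x ≡ true
eqB-refl false = refl
eqB-refl true  = refl

lexLeq-refl : ∀ {n} (w : Word n) → lexLeq w w ≡ true
lexLeq-refl []      = refl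
lexLeq-refl (x ∷ w) rewrite eqB-refl x = lexLeq-refl w

edgesAmong-++ : ∀ {n} s (V W : List (Word n)) → edgesAmong s (V ++ W) ≡ edgesAmong s V ++ edgesAmong s W
edgesAmong-++ s V W = trans (cong (map _) (filter-++ _ V W)) (map-++ _ (filterᵇ _ V) (filterᵇ _ W))

filterᵇ-map : ∀ {A B : Set} {p : B → Bool} {q : A → Bool} (f : A → B) → (∀ a → p (f a) ≡ q a) →
              ∀ xs → filterᵇ p (map f xs) ≡ map f (filterᵇ q xs)
filterᵇ-map f p∘f≗q []       = refl
filterᵇ-map {q = q} f p∘f≗q (x ∷ xs) rewrite p∘f≗q x with q x
... | true  = cong (f x ∷_) (filterᵇ-map f p∘f≗q xs)
... | false = filterᵇ-map f p∘f≗q xs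

module _ {n : ℕ} where

  edgesAmong-prefix : ∀ x s t → (∀ (w : Word n) → act s (x ∷ w) ≡ x ∷ act t w) →
                      ∀ W → edgesAmong s (map (x ∷_) W) ≡ map (prefix x) (edgesAmong t W)
  edgesAmong-prefix x s t s≈t W = begin
    map (λ u → u , act s u) (filterᵇ (λ u → lexLeq u (act s u)) (map (x ∷_) W))
      ≡⟨ cong (map _) (filterᵇ-map (x ∷_) same-test W) ⟩
    map (λ u → u , act s u) (map (x ∷_) (filterᵇ (λ u → lexLeq u (act t u)) W))
      ≡⟨ map-∘ _ ⟨
    map (λ w → x ∷ w , act s (x ∷ w)) (filterᵇ (λ u → lexLeq u (act t u)) W)
      ≡⟨ map-cong (λ w → cong (x ∷ w ,_) (s≈t w)) _ ⟩
    map (λ w → x ∷ w , x ∷ act t w) (filterᵇ (λ u → lexLeq u (act t u)) W)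
      ≡⟨ map-∘ _ ⟩
    map (prefix x) (edgesAmong t W) ∎
    where
    same-test : ∀ w → lexLeq (x ∷ w) (act s (x ∷ w)) ≡ lexLeq w (act t w)
    same-test w rewrite s≈t w | eqB-refl x = refl

  edgesAmong-a-false : ∀ (W : List (Word n)) →
                       edgesAmong ga (map (false ∷_) W) ≡ map (λ w → false ∷ w , true ∷ w) W
  edgesAmong-a-false []      = refl
  edgesAmong-a-false (w ∷ W) = cong (_ ∷_) (edgesAmong-a-false W)

  edgesAmong-a-true : ∀ (W : List (Word n)) → edgesAmong ga (map (true ∷_) W) ≡ []
  edgesAmong-a-true []      = refl
  edgesAmong-a-true (w ∷ W) = edgesAmong-a-true W

  edgesAmong-d-false : ∀ (W : List (Word n)) → edgesAmong gd (map (false ∷_) W) ≡ map (loopAt ∘ (false ∷_)) W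
  edgesAmong-d-false []      = refl
  edgesAmong-d-false (w ∷ W) rewrite lexLeq-refl w = cong (_ ∷_) (edgesAmong-d-false W)

  private
    W = words n

  edgesOf-a-suc : edgesOf ga (suc n) ≡ map (λ w → false ∷ w , true ∷ w) W
  edgesOf-a-suc = begin
    edgesAmong ga (map (false ∷_) W ++ map (true ∷_) W)
      ≡⟨ edgesAmong-++ ga (map (false ∷_) W) (map (true ∷_) W) ⟩
    edgesAmong ga (map (false ∷_) W) ++ edgesAmong ga (map (true ∷_) W)
      ≡⟨ cong₂ _++_ (edgesAmong-a-false W) (edgesAmong-a-true W) ⟩
    map (λ w → false ∷ w , true ∷ w) W ++ []
      ≡⟨ ++-identityʳ _ ⟩
    map (λ w → false ∷ w , true ∷ w) W ∎

  edgesOf-b-suc : edgesOf gb (suc n) ≡ map (prefix false) (edgesOf ga n) ++ map (prefix true) (edgesOf gc n)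
  edgesOf-b-suc = trans (edgesAmong-++ gb (map (false ∷_) W) (map (true ∷_) W))
    (cong₂ _++_ (edgesAmong-prefix false gb ga (λ _ → refl) W) (edgesAmong-prefix true gb gc (λ _ → refl) W))

  edgesOf-c-suc : edgesOf gc (suc n) ≡ map (prefix false) (edgesOf ga n) ++ map (prefix true) (edgesOf gd n)
  edgesOf-c-suc = trans (edgesAmong-++ gc (map (false ∷_) W) (map (true ∷_) W))
    (cong₂ _++_ (edgesAmong-prefix false gc ga (λ _ → refl) W) (edgesAmong-prefix true gc gd (λ _ → refl) W))

  edgesOf-d-suc : edgesOf gd (suc n) ≡ map (loopAt ∘ (false ∷_)) W ++ map (prefix true) (edgesOf gb n)
  edgesOf-d-suc = trans (edgesAmong-++ gd (map (false ∷_) W) (map (true ∷_) W))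
    (cong₂ _++_ (edgesAmong-d-false W) (edgesAmong-prefix true gd gb (λ _ → refl) W))

length-words : ∀ n → length (words n) ≡ 2 ^ n
length-words zero    = refl
length-words (suc n) = begin
  length (map (false ∷_) (words n) ++ map (true ∷_) (words n))
    ≡⟨ length-++ (map (false ∷_) (words n)) ⟩
  length (map (false ∷_) (words n)) + length (map (true ∷_) (words n))
    ≡⟨ cong₂ _+_ (length-map (false ∷_) (words n)) (length-map (true ∷_) (words n)) ⟩
  length (words n) + length (words n)
    ≡⟨ cong₂ _+_ (length-words n) (trans (length-words n) (sym (+-identityʳ (2 ^ n)))) ⟩
  2 ^ suc n ∎

-- The gap crossed by a step between positions p and q; meaningless unless |p − q| ≤ 1.
gap : ℕ → ℕ → Maybe ℕ
gap zero    zero    = nothing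
gap zero    (suc _) = just zero
gap (suc _) zero    = just zero
gap (suc p) (suc q) = Data.Maybe.map suc (gap p q)

gap-refl : ∀ p → gap p p ≡ nothing
gap-refl zero    = refl
gap-refl (suc p) = cong (Data.Maybe.map suc) (gap-refl p)

gap-up : ∀ p → gap p (suc p) ≡ just p
gap-up zero    = refl
gap-up (suc p) = cong (Data.Maybe.map suc) (gap-up p)

gap-down : ∀ p → gap (suc p) p ≡ just p
gap-down zero    = refl
gap-down (suc p) = cong (Data.Maybe.map suc) (gap-down p)

data Adjacent : ℕ → ℕ → Set where
  loop : ∀ p → Adjacent p p
  up   : ∀ p → Adjacent p (suc p)
  down : ∀ p → Adjacent (suc p) p

-- In Γ (n + 1) the a-edges are EvenSteps and the b-, c-, d-edges OddStepOrLoops; this parity is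
-- what keeps prefixed edges between consecutive positions (prefix-false-step, prefix-true-step).
data EvenStep : ℕ → ℕ → Set where
  up   : ∀ k → EvenStep (double k) (suc (double k))
  down : ∀ k → EvenStep (suc (double k)) (double k)

data OddStepOrLoop : ℕ → ℕ → Set where
  loop : ∀ p → OddStepOrLoop p p
  up   : ∀ k → OddStepOrLoop (suc (double k)) (double (suc k))
  down : ∀ k → OddStepOrLoop (double (suc k)) (suc (double k))

OnPositions : (ℕ → ℕ → Set) → ∀ {n} → Word n × Word n → Set
OnPositions R e = R (position (proj₁ e)) (position (proj₂ e))

edgeGap : ∀ {n} → Word n × Word n → Maybe ℕ
edgeGap e = gap (position (proj₁ e)) (position (proj₂ e))

liftGap : Maybe ℕ → Maybe ℕ
liftGap = Data.Maybe.map (suc ∘ double)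

prefix-false-step : ∀ {p q} → EvenStep p q →
  OddStepOrLoop (extend false p) (extend false q) × gap (extend false p) (extend false q) ≡ liftGap (gap p q)
prefix-false-step (up k) rewrite extend-false-double k | extend-false-suc-double k | gap-up (double k) =
  up (double k) , gap-up (suc (double (double k)))
prefix-false-step (down k) rewrite extend-false-double k | extend-false-suc-double k | gap-down (double k) =
  down (double k) , gap-down (suc (double (double k)))

prefix-true-step : ∀ {p q} → OddStepOrLoop p q →
  OddStepOrLoop (extend true p) (extend true q) × gap (extend true p) (extend true q) ≡ liftGap (gap p q)
prefix-true-step (loop p) rewrite gap-refl p | gap-refl (extend true p) = loop _ , refl
prefix-true-step (up k)
  rewrite extend-true-suc-double k | extend-true-double (suc k) | gap-up (suc (double k)) =
  up (suc (double k)) , gap-up (suc (double (suc (double k))))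
prefix-true-step (down k)
  rewrite extend-true-suc-double k | extend-true-double (suc k) | gap-down (suc (double k)) =
  down (suc (double k)) , gap-down (suc (double (suc (double k))))

a-edge-step : ∀ p → EvenStep (extend false p) (extend true p) ×
                    gap (extend false p) (extend true p) ≡ just (double p)
a-edge-step p with parity p
... | even r rewrite extend-false-double r | extend-true-double r =
  down (double r) , gap-down (double (double r))
... | odd r rewrite extend-false-suc-double r | extend-true-suc-double r =
  up (suc (double r)) , gap-up (double (suc (double r)))

gaps : ∀ {n} → List (Word n × Word n) → List (Maybe ℕ)
gaps = map edgeGap

map-edges : ∀ {X : Set} {n} {P : X → Set} {Q : Word n × Word n → Set}
            (f : X → Word n × Word n) (γ : X → Maybe ℕ) → (∀ {x} → P x → Q (f x) × edgeGap (f x) ≡ γ x) →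
            ∀ {xs} → All P xs → All Q (map f xs) × gaps (map f xs) ≡ map γ xs
map-edges f γ step ps =
  map⁺ (All.map (proj₁ ∘ step) ps) , trans (sym (map-∘ _)) (map-cong-local (All.map (proj₂ ∘ step) ps))

gapsOf : Gen → (n : ℕ) → List (Maybe ℕ)
gapsOf s n = gaps (edgesOf s n)

bcdGaps : ℕ → List (Maybe ℕ)
bcdGaps n = gapsOf gb n ++ gapsOf gc n ++ gapsOf gd n

module _ {n : ℕ} where

  private
    W = words n

  a-edges : All (OnPositions EvenStep) (edgesOf ga (suc n)) ×
            gapsOf ga (suc n) ≡ map (just ∘ double ∘ position) W
  a-edges rewrite edgesOf-a-suc {n} =
    map-edges (λ w → false ∷ w , true ∷ w) (just ∘ double ∘ position) (λ {w} _ → a-edge-step (position w))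
      (All.universal (λ _ → tt) W)

  a-multiplicity-even : ∀ k → k < 2 ^ n → multiplicity (double k) (gapsOf ga (suc n)) ≡ 1
  a-multiplicity-even k k<2^n = begin
    multiplicity (double k) (gapsOf ga (suc n))
      ≡⟨ cong (multiplicity (double k)) (proj₂ a-edges) ⟩
    multiplicity (double k) (map (just ∘ double ∘ position) W)
      ≡⟨ count-map _ (just ∘ double ∘ position) W ⟩
    count (λ w → double (position w) ≡ᵇ double k) W
      ≡⟨ count-cong (λ w → double-≡ᵇ-double (position w) k) W ⟩
    count (λ w → position w ≡ᵇ k) W
      ≡⟨ positions-fibre n k k<2^n ⟩
    1 ∎

  a-multiplicity-odd : ∀ k → multiplicity (suc (double k)) (gapsOf ga (suc n)) ≡ 0
  a-multiplicity-odd k = begin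
    multiplicity (suc (double k)) (gapsOf ga (suc n))
      ≡⟨ cong (multiplicity (suc (double k))) (proj₂ a-edges) ⟩
    multiplicity (suc (double k)) (map (just ∘ double ∘ position) W)
      ≡⟨ count-map _ (just ∘ double ∘ position) W ⟩
    count (λ w → double (position w) ≡ᵇ suc (double k)) W
      ≡⟨ count-none (λ w → double-≡ᵇ-suc-double (position w) k) W ⟩
    0 ∎

  a-loops : loops (gapsOf ga (suc n)) ≡ 0
  a-loops = trans (cong loops (proj₂ a-edges)) (trans (count-map _ _ W) (count-none (λ _ → refl) W))

multiplicity-liftGap-odd : ∀ k s → multiplicity (suc (double k)) (map liftGap s) ≡ multiplicity k s
multiplicity-liftGap-odd k s = trans (count-map _ liftGap s) (count-cong same-test s)
  where
  same-test : ∀ m → does (liftGap m ≟ₘ just (suc (double k))) ≡ does (m ≟ₘ just k)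
  same-test nothing  = refl
  same-test (just j) = double-≡ᵇ-double j k

multiplicity-liftGap-even : ∀ k s → multiplicity (double k) (map liftGap s) ≡ 0
multiplicity-liftGap-even k s = trans (count-map _ liftGap s) (count-none never s)
  where
  never : ∀ m → does (liftGap m ≟ₘ just (double k)) ≡ false
  never nothing  = refl
  never (just j) = suc-double-≡ᵇ-double j k

loops-liftGap : ∀ s → loops (map liftGap s) ≡ loops s
loops-liftGap s = trans (count-map _ liftGap s) (count-cong same-test s)
  where
  same-test : ∀ m → is-nothing (liftGap m) ≡ is-nothing m
  same-test nothing  = refl
  same-test (just _) = refl

prefix-false-edges : ∀ {n} {L : List (Word n × Word n)} → All (OnPositions EvenStep) L →
  All (OnPositions OddStepOrLoop) (map (prefix false) L) × gaps (map (prefix false) L) ≡ map liftGap (gaps L)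
prefix-false-edges {L = L} =
  map₂ (λ eq → trans eq (map-∘ L)) ∘ map-edges (prefix false) (liftGap ∘ edgeGap) prefix-false-step

prefix-true-edges : ∀ {n} {L : List (Word n × Word n)} → All (OnPositions OddStepOrLoop) L →
  All (OnPositions OddStepOrLoop) (map (prefix true) L) × gaps (map (prefix true) L) ≡ map liftGap (gaps L)
prefix-true-edges {L = L} =
  map₂ (λ eq → trans eq (map-∘ L)) ∘ map-edges (prefix true) (liftGap ∘ edgeGap) prefix-true-step

loop-edges : ∀ {n} (W : List (Word n)) →
  All (OnPositions OddStepOrLoop) (map (loopAt ∘ (false ∷_)) W) ×
  gaps (map (loopAt ∘ (false ∷_)) W) ≡ map (const nothing) W
loop-edges W = map-edges (loopAt ∘ (false ∷_)) (const nothing)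
  (λ {w} _ → loop _ , gap-refl (position (false ∷ w))) (All.universal (λ _ → tt) W)

record BCDLevel (n : ℕ) : Set where
  field
    b-steps   : All (OnPositions OddStepOrLoop) (edgesOf gb (suc n))
    c-steps   : All (OnPositions OddStepOrLoop) (edgesOf gc (suc n))
    d-steps   : All (OnPositions OddStepOrLoop) (edgesOf gd (suc n))
    even-gaps : ∀ k → multiplicity (double k) (bcdGaps (suc n)) ≡ 0
    odd-gaps  : ∀ k → suc (suc (double k)) < 2 ^ suc n → multiplicity (suc (double k)) (bcdGaps (suc n)) ≡ 2
    bcd-loops : loops (bcdGaps (suc n)) ≡ 2 ^ suc n + 4

bcdLevel-zero : BCDLevel zero
bcdLevel-zero = record
  { b-steps   = loop _ ∷ loop _ ∷ []
  ; c-steps   = loop _ ∷ loop _ ∷ []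
  ; d-steps   = loop _ ∷ loop _ ∷ []
  ; even-gaps = λ _ → refl
  ; odd-gaps  = λ { _ (s≤s (s≤s ())) }
  ; bcd-loops = refl
  }

bcdLevel-suc : ∀ {n} → BCDLevel n → BCDLevel (suc n)
bcdLevel-suc {n} L = record
  { b-steps   = subst (All _) (sym (edgesOf-b-suc {m})) (++⁺ (proj₁ A↑) (proj₁ C↑))
  ; c-steps   = subst (All _) (sym (edgesOf-c-suc {m})) (++⁺ (proj₁ A↑) (proj₁ D↑))
  ; d-steps   = subst (All _) (sym (edgesOf-d-suc {m})) (++⁺ (proj₁ (loop-edges W)) (proj₁ B↑))
  ; even-gaps = even-gaps′
  ; odd-gaps  = odd-gaps′
  ; bcd-loops = bcd-loops′
  }
  where
  open BCDLevel L
  m = suc n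
  W = words m
  A = gapsOf ga m
  B = gapsOf gb m
  C = gapsOf gc m
  D = gapsOf gd m
  A↑ = prefix-false-edges (proj₁ (a-edges {n}))
  B↑ = prefix-true-edges b-steps
  C↑ = prefix-true-edges c-steps
  D↑ = prefix-true-edges d-steps

  ↑A = map liftGap A
  ↑B = map liftGap B
  ↑C = map liftGap C
  ↑D = map liftGap D
  N = map (const nothing) W

  gaps-++ : ∀ (E₁ : List (Word (suc m) × Word (suc m))) {E₂ s t} → gaps E₁ ≡ s → gaps E₂ ≡ t →
            gaps (E₁ ++ E₂) ≡ s ++ t
  gaps-++ E₁ refl refl = map-++ edgeGap E₁ _

  b-gaps : gapsOf gb (suc m) ≡ ↑A ++ ↑C
  b-gaps = trans (cong gaps (edgesOf-b-suc {m}))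
                 (gaps-++ (map (prefix false) (edgesOf ga m)) (proj₂ A↑) (proj₂ C↑))

  c-gaps : gapsOf gc (suc m) ≡ ↑A ++ ↑D
  c-gaps = trans (cong gaps (edgesOf-c-suc {m}))
                 (gaps-++ (map (prefix false) (edgesOf ga m)) (proj₂ A↑) (proj₂ D↑))

  d-gaps : gapsOf gd (suc m) ≡ N ++ ↑B
  d-gaps = trans (cong gaps (edgesOf-d-suc {m}))
                 (gaps-++ (map (loopAt ∘ (false ∷_)) W) (proj₂ (loop-edges W)) (proj₂ B↑))

  split : ∀ p → count p (bcdGaps (suc m)) ≡
                (count p ↑A + count p ↑C) + ((count p ↑A + count p ↑D) + (count p N + count p ↑B))
  split p rewrite b-gaps | c-gaps | d-gaps | count-++ p (↑A ++ ↑C) ((↑A ++ ↑D) ++ (N ++ ↑B))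
    | count-++ p ↑A ↑C | count-++ p (↑A ++ ↑D) (N ++ ↑B) | count-++ p ↑A ↑D | count-++ p N ↑B = refl

  N-multiplicity : ∀ j → multiplicity j N ≡ 0
  N-multiplicity j = trans (count-map _ (const nothing) W) (count-none (λ _ → refl) W)

  N-loops : loops N ≡ 2 ^ m
  N-loops = trans (count-map _ (const nothing) W) (trans (count-all (λ _ → refl) W) (length-words m))

  count-bcd : ∀ p → count p (bcdGaps m) ≡ count p B + (count p C + count p D)
  count-bcd p = trans (count-++ p B (C ++ D)) (cong (count p B +_) (count-++ p C D))

  even-gaps′ : ∀ k → multiplicity (double k) (bcdGaps (suc m)) ≡ 0
  even-gaps′ k rewrite split (λ x → does (x ≟ₘ just (double k))) | N-multiplicity (double k)
    | multiplicity-liftGap-even k A | multiplicity-liftGap-even k B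
    | multiplicity-liftGap-even k C | multiplicity-liftGap-even k D = refl

  half-bound : ∀ q → suc (double q) < 2 ^ m → q < 2 ^ n
  half-bound q h = double-cancel-< (<-trans (n<1+n _) (subst (suc (double q) <_) (2^suc≡double n) h))

  odd-count : ∀ k → suc k < 2 ^ m → multiplicity k A + multiplicity k A + multiplicity k (bcdGaps m) ≡ 2
  odd-count k sk<2^m with parity k
  ... | even q rewrite a-multiplicity-even {n} q (half-bound q sk<2^m) | even-gaps q = refl
  ... | odd q rewrite a-multiplicity-odd {n} q | odd-gaps q sk<2^m = refl

  odd-gaps′ : ∀ k → suc (suc (double k)) < 2 ^ suc m → multiplicity (suc (double k)) (bcdGaps (suc m)) ≡ 2
  odd-gaps′ k bound rewrite split (λ x → does (x ≟ₘ just (suc (double k)))) | N-multiplicity (suc (double k))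
    | multiplicity-liftGap-odd k A | multiplicity-liftGap-odd k B
    | multiplicity-liftGap-odd k C | multiplicity-liftGap-odd k D =
    trans (rearrange (multiplicity k A) (multiplicity k B) (multiplicity k C) (multiplicity k D))
          (trans (cong (multiplicity k A + multiplicity k A +_) (sym (count-bcd _)))
                 (odd-count k (double-cancel-< (subst (suc (suc (double k)) <_) (2^suc≡double m) bound))))
    where
    rearrange : ∀ a b c d → (a + c) + ((a + d) + (0 + b)) ≡ (a + a) + (b + (c + d))
    rearrange = solve-∀

  bcd-loops′ : loops (bcdGaps (suc m)) ≡ 2 ^ suc m + 4
  bcd-loops′ rewrite split is-nothing | N-loops
    | loops-liftGap A | a-loops {n} | loops-liftGap B | loops-liftGap C | loops-liftGap D =
    trans (rearrange (2 ^ m) (loops B) (loops C) (loops D))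
          (trans (cong (2 ^ m +_) (trans (sym (count-bcd is-nothing)) bcd-loops)) (double-plus (2 ^ m)))
    where
    rearrange : ∀ w b c d → (0 + c) + ((0 + d) + (w + b)) ≡ w + (b + (c + d))
    rearrange = solve-∀
    double-plus : ∀ w → w + (w + 4) ≡ 2 * w + 4
    double-plus = solve-∀

bcdLevel : ∀ n → BCDLevel n
bcdLevel zero    = bcdLevel-zero
bcdLevel (suc n) = bcdLevel-suc (bcdLevel n)

EvenStep⇒Adjacent : ∀ {p q} → EvenStep p q → Adjacent p q
EvenStep⇒Adjacent (up k)   = up _
EvenStep⇒Adjacent (down k) = down _

OddStepOrLoop⇒Adjacent : ∀ {p q} → OddStepOrLoop p q → Adjacent p q
OddStepOrLoop⇒Adjacent (loop p) = loop p
OddStepOrLoop⇒Adjacent (up k)   = up _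
OddStepOrLoop⇒Adjacent (down k) = down _

module _ (n : ℕ) where

  private
    open BCDLevel (bcdLevel n)
    adj : ∀ {L : List (Word (suc n) × Word (suc n))} →
          All (OnPositions OddStepOrLoop) L → All (OnPositions Adjacent) L
    adj = All.map OddStepOrLoop⇒Adjacent

  edges-adjacent : All (OnPositions Adjacent) (edges (suc n))
  edges-adjacent = ++⁺ (All.map EvenStep⇒Adjacent (proj₁ (a-edges {n})))
                  (++⁺ (adj b-steps) (++⁺ (adj c-steps) (++⁺ (adj d-steps) [])))

  gaps-edges : gaps (edges (suc n)) ≡ gapsOf ga (suc n) ++ bcdGaps (suc n)
  gaps-edges = begin
    gaps (A ++ B ++ C ++ D ++ [])                ≡⟨ map-++ edgeGap A _ ⟩
    gaps A ++ gaps (B ++ C ++ D ++ [])           ≡⟨ cong (gaps A ++_) (map-++ edgeGap B _) ⟩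
    gaps A ++ gaps B ++ gaps (C ++ D ++ [])      ≡⟨ cong (λ x → gaps A ++ gaps B ++ x) (map-++ edgeGap C _) ⟩
    gaps A ++ gaps B ++ gaps C ++ gaps (D ++ []) ≡⟨ cong (λ E → gaps A ++ gaps B ++ gaps C ++ gaps E) (++-identityʳ D) ⟩
    gaps A ++ gaps B ++ gaps C ++ gaps D         ∎
    where
    A = edgesOf ga (suc n)
    B = edgesOf gb (suc n)
    C = edgesOf gc (suc n)
    D = edgesOf gd (suc n)

  count-edges : ∀ p → count p (gaps (edges (suc n))) ≡ count p (gapsOf ga (suc n)) + count p (bcdGaps (suc n))
  count-edges p = trans (cong (count p) gaps-edges) (count-++ p (gapsOf ga (suc n)) _)

  multiplicity-even-gap : ∀ k → k < 2 ^ n → multiplicity (double k) (gaps (edges (suc n))) ≡ 1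
  multiplicity-even-gap k k<2^n rewrite count-edges (λ m → does (m ≟ₘ just (double k)))
    | a-multiplicity-even {n} k k<2^n | even-gaps k = refl

  multiplicity-odd-gap : ∀ k → suc (suc (double k)) < 2 ^ suc n →
                         multiplicity (suc (double k)) (gaps (edges (suc n))) ≡ 2
  multiplicity-odd-gap k bound rewrite count-edges (λ m → does (m ≟ₘ just (suc (double k))))
    | a-multiplicity-odd {n} k | odd-gaps k bound = refl

  loops-edges : loops (gaps (edges (suc n))) ≡ 2 ^ suc n + 4
  loops-edges rewrite count-edges is-nothing | a-loops {n} = bcd-loops

-- Connectivity

gap-crossing : ∀ {p q j} → Adjacent p q → p ≤ j → j < q → gap p q ≡ just j
gap-crossing (loop p) p≤j j<p = contradiction p≤j (<⇒≱ j<p)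
gap-crossing (up p)   p≤j j<sp rewrite ≤-antisym p≤j (≤-pred j<sp) = gap-up _
gap-crossing (down q) sq≤j j<q = contradiction (≤-trans (n≤1+n q) sq≤j) (<⇒≱ j<q)

gap-crossing′ : ∀ {p q j} → Adjacent p q → q ≤ j → j < p → gap p q ≡ just j
gap-crossing′ (loop p) p≤j j<p = contradiction p≤j (<⇒≱ j<p)
gap-crossing′ (up p)   sp≤j j<p = contradiction (≤-trans (n≤1+n p) sp≤j) (<⇒≱ j<p)
gap-crossing′ (down q) q≤j j<sq rewrite ≤-antisym q≤j (≤-pred j<sq) = gap-down _

gap-ends : ∀ {p q j} → Adjacent p q → gap p q ≡ just j → (p ≡ j × q ≡ suc j) ⊎ (p ≡ suc j × q ≡ j)
gap-ends (loop p) eq rewrite gap-refl p with () ← eq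
gap-ends (up p)   eq rewrite gap-up p with refl ← eq = inj₁ (refl , refl)
gap-ends (down q) eq rewrite gap-down q with refl ← eq = inj₂ (refl , refl)

module _ {n : ℕ} {S : SpanningSubgraph n} where

  Reach-trans : ∀ {u v w} → Reach {n} S u v → Reach {n} S v w → Reach {n} S u w
  Reach-trans here          r′ = r′
  Reach-trans (fwd e e∈S r) r′ = fwd e e∈S (Reach-trans r r′)
  Reach-trans (bwd e e∈S r) r′ = bwd e e∈S (Reach-trans r r′)

  Reach-sym : ∀ {u v} → Reach {n} S u v → Reach {n} S v u
  Reach-sym here          = here
  Reach-sym (fwd e e∈S r) = Reach-trans (Reach-sym r) (bwd {n} {S} e e∈S here)
  Reach-sym (bwd e e∈S r) = Reach-trans (Reach-sym r) (fwd {n} {S} e e∈S here)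

  crossing-edge : ∀ {P : Word n → Set} → Decidable P → ∀ {u v} → Reach {n} S u v → P u → ¬ P v →
                  ∃[ e ] e ∈ₛ S × ((P (src {n} e) × ¬ P (tgt {n} e)) ⊎ (¬ P (src {n} e) × P (tgt {n} e)))
  crossing-edge P? here Pu ¬Pv = contradiction Pu ¬Pv
  crossing-edge P? (fwd e e∈S r) Pu ¬Pv with P? (tgt {n} e)
  ... | yes Pt = crossing-edge P? r Pt ¬Pv
  ... | no ¬Pt = e , e∈S , inj₁ (Pu , ¬Pt)
  crossing-edge P? (bwd e e∈S r) Pu ¬Pv with P? (src {n} e)
  ... | yes Ps = crossing-edge P? r Ps ¬Pv
  ... | no ¬Ps = e , e∈S , inj₂ (¬Ps , Pu)

module _ {n : ℕ} (adjacent : All (OnPositions Adjacent) (edges n)) where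

  private
    M = 2 ^ n ∸ 1

    edge-adjacent : (e : Edge n) → Adjacent (position (src {n} e)) (position (tgt {n} e))
    edge-adjacent e = All.lookup adjacent (∈-lookup e)

    gap-below : ∀ {j} (w : Word n) → position w ≡ suc j → j < M
    gap-below {j} w pw≡sj =
      ≤-pred (subst (suc j <_) (sym (suc[2^n∸1]≡2^n n)) (subst (_< 2 ^ n) pw≡sj (position<2^n w)))

    position-lastWord≡M : position (lastWord n) ≡ M
    position-lastWord≡M = suc-injective (trans (position-lastWord n) (sym (suc[2^n∸1]≡2^n n)))

  Connected⇒Covers : ∀ S → Connected {n} S → Covers edgeGap (edges n) (downFrom M) S
  Connected⇒Covers S conn {j} j∈R
    with crossing-edge (λ w → position w ≤? j) (conn (firstWord n) (lastWord n))
           (subst (_≤ j) (sym (position-firstWord n)) z≤n)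
           (subst (λ p → ¬ p ≤ j) (sym position-lastWord≡M) (<⇒≱ (∈-downFrom⁻ j∈R)))
  ... | e , e∈S , inj₁ (s≤j , t≰j) = e , e∈S , gap-crossing (edge-adjacent e) s≤j (≰⇒> t≰j)
  ... | e , e∈S , inj₂ (s≰j , t≤j) = e , e∈S , gap-crossing′ (edge-adjacent e) t≤j (≰⇒> s≰j)

  Covers⇒Connected : ∀ S → Covers edgeGap (edges n) (downFrom M) S → Connected {n} S
  Covers⇒Connected S cov u v = Reach-trans (Reach-sym (reach (position u) u refl)) (reach (position v) v refl)
    where
    reach : ∀ k w → position w ≡ k → Reach {n} S (firstWord n) w
    reach zero w pw≡0
      rewrite position-injective {u = w} {firstWord n} (trans pw≡0 (sym (position-firstWord n))) = here
    reach (suc j) w pw≡sj with e , e∈S , gap≡j ← cov (∈-downFrom⁺ (gap-below w pw≡sj))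
      with gap-ends (edge-adjacent e) gap≡j
    ... | inj₁ (s≡j , t≡sj) = Reach-trans (reach j (src {n} e) s≡j)
      (fwd e e∈S (subst (Reach S (tgt {n} e)) (position-injective (trans t≡sj (sym pw≡sj))) here))
    ... | inj₂ (s≡sj , t≡j) = Reach-trans (reach j (tgt {n} e) t≡j)
      (bwd e e∈S (subst (Reach S (src {n} e)) (position-injective (trans s≡sj (sym pw≡sj))) here))

  Connected⇔Covers : ∀ S → Connected {n} S ⇔ Covers edgeGap (edges n) (downFrom M) S
  Connected⇔Covers S = mk⇔ (Connected⇒Covers S) (Covers⇒Connected S)

  gaps-inside : All (Maybe.All (_∈ downFrom M)) (gaps (edges n))
  gaps-inside =
    map⁺ (All.map (λ {e} adj → gap-inside adj (position<2^n (proj₁ e)) (position<2^n (proj₂ e))) adjacent)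
    where
    below-M : ∀ {p} → suc p < 2 ^ n → p ∈ downFrom M
    below-M sp<2^n = ∈-downFrom⁺ (≤-pred (subst (_ <_) (sym (suc[2^n∸1]≡2^n n)) sp<2^n))
    gap-inside : ∀ {p q} → Adjacent p q → p < 2 ^ n → q < 2 ^ n → Maybe.All (_∈ downFrom M) (gap p q)
    gap-inside (loop p) _ _    rewrite gap-refl p = Maybe.nothing
    gap-inside (up p)   _ sp<  rewrite gap-up p   = Maybe.just (below-M sp<)
    gap-inside (down q) sq< _  rewrite gap-down q = Maybe.just (below-M sq<)

choices-downFrom : ∀ K s → (∀ k → k ≤ K → multiplicity (double k) s ≡ 1) →
                   (∀ k → k < K → multiplicity (suc (double k)) s ≡ 2) →
                   choices (downFrom (suc (double K))) s ≡ 3 ^ K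
choices-downFrom zero    s ones twos rewrite ones 0 z≤n = refl
choices-downFrom (suc K) s ones twos rewrite ones (suc K) ≤-refl | twos K ≤-refl
  | choices-downFrom K s (λ k k≤K → ones k (m≤n⇒m≤1+n k≤K)) (λ k k<K → twos k (m≤n⇒m≤1+n k<K)) = +-identityʳ _

numCoverings-edges : ∀ n → numCoverings (downFrom (2 ^ suc n ∸ 1)) (gaps (edges (suc n)))
                             ≡ 2 ^ (2 ^ suc n + 4) * 3 ^ (2 ^ n ∸ 1)
numCoverings-edges n = begin
  2 ^ free R (gaps E) * choices R (gaps E)
    ≡⟨ cong (λ f → 2 ^ f * choices R (gaps E)) (free-all-inside (gaps-inside (edges-adjacent n))) ⟩
  2 ^ loops (gaps E) * choices R (gaps E)
    ≡⟨ cong₂ (λ l c → 2 ^ l * c) (loops-edges n) choices-edges ⟩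
  2 ^ (2 ^ suc n + 4) * 3 ^ K ∎
  where
  K = 2 ^ n ∸ 1
  E = edges (suc n)
  R = downFrom (2 ^ suc n ∸ 1)
  2^suc≡ : 2 ^ suc n ≡ suc (suc (double K))
  2^suc≡ = trans (2^suc≡double n) (cong double (sym (suc[2^n∸1]≡2^n n)))
  choices-edges : choices R (gaps E) ≡ 3 ^ K
  choices-edges = subst (λ m → choices (downFrom (m ∸ 1)) (gaps E) ≡ 3 ^ K) (sym 2^suc≡)
    (choices-downFrom K (gaps E)
      (λ k k≤K → multiplicity-even-gap n k (subst (suc k ≤_) (suc[2^n∸1]≡2^n n) (s≤s k≤K)))
      (λ k k<K → multiplicity-odd-gap n k (subst (suc (suc (double k)) <_) (sym 2^suc≡)
                   (s≤s (s≤s (≤-trans (n≤1+n _) (double-mono-≤ k<K)))))))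

mainTheorem4 : (n : ℕ) → 1 ≤ n →
    NumConnectedSpanning n (2 ^ (2 ^ n + 4) * 3 ^ (2 ^ (n ∸ 1) ∸ 1))
mainTheorem4 (suc n) _ =
  coveringSubsets edgeGap E R ,
  coveringSubsets-unique edgeGap E R ,
  (λ S → ⇔.trans (∈-coveringSubsets edgeGap E R S) (⇔.sym (Connected⇔Covers (edges-adjacent n) S))) ,
  trans (length-coveringSubsets edgeGap E (Unique.downFrom⁺ _)) (numCoverings-edges n)
  where
  E = edges (suc n)
  R = downFrom (2 ^ suc n ∸ 1)
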